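{- Let $\mathcal{F}=\{i_{\alpha\beta}:\mathbb{B}_\alpha\to\mathbb{B}_\beta:\alpha\le\beta<\lambda\}$ be a complete iteration system and let $A\subseteq T(\mathcal{F})$ be an antichain such that $\pi_{\alpha\lambda}[A]=\{f(\alpha):f\in A\}$ is an antichain of $\mathbb{B}_\alpha$ for some $\alpha<\lambda$. Then the pointwise supremum $\tilde\bigvee A$ is the supremum of $A$ in ${\sf RO}(T(\mathcal{F}))$.
   Context: A regular embedding is an injective boolean homomorphism preserving arbitrary suprema, with retraction $\pi_i(c)=\bigwedge\{b:i(b)\ge c\}$. A complete iteration system: complete boolean algebras $\mathbb{B}_\alpha$, regular embeddings $i_{\alpha\beta}$ with retractions $\pi_{\alpha\beta}$, $i_{\alpha\alpha}=\mathrm{id}$, $i_{\beta\gamma}\circ i_{\alpha\beta}=i_{\alpha\gamma}$. $T(\mathcal{F})=\{f\in\prod_{\alpha<\lambda}\mathbb{B}_\alpha:\pi_{\alpha\beta}(f(\beta))=f(\alpha)\ \forall\alpha\le\beta<\lambda\}$, ordered pointwise; two threads are incompatible if no nonzero thread lies below both. $\pi_{\alpha\lambda}(f)=f(\alpha)$. The pointwise supremum is $\tilde\bigvee A=\langle\bigvee\{f(\alpha):f\in A\}:\alpha<\lambda\rangle$ (a thread). ${\sf RO}(T(\mathcal{F}))$ is the boolean completion of the poset of nonzero threads, into which $T(\mathcal{F})$ embeds densely. -}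

module Defs where

open import Level using (Level; suc; _⊔_)
open import Data.Product using (Σ; _×_; _,_; ∃)
open import Data.Sum using (_⊎_)
open import Relation.Nullary using (¬_)
open import Relation.Binary.PropositionalEquality using (_≡_)
open import Relation.Binary.Structures using (IsStrictTotalOrder)
open import Induction.WellFounded using (WellFounded)
open import Algebra.Lattice.Bundles using (BooleanAlgebra)

record CompleteBooleanAlgebra (ℓ : Level) : Set (suc ℓ) where
  field
    boolAlg : BooleanAlgebra ℓ ℓ
  open BooleanAlgebra boolAlg public

  _≤_ : Carrier → Carrier → Set ℓ
  x ≤ y = (x ∧ y) ≈ x

  field
    ⋁        : (Carrier → Set ℓ) → Carrier
    ⋁-upper  : (S : Carrier → Set ℓ) → ∀ x → S x → x ≤ ⋁ S
    ⋁-least  : (S : Carrier → Set ℓ) → ∀ u → (∀ x → S x → x ≤ u) → ⋁ S ≤ u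

  ⋀ : (Carrier → Set ℓ) → Carrier
  ⋀ S = ⋁ (λ x → ∀ y → S y → x ≤ y)

open CompleteBooleanAlgebra using (Carrier)

record IsRegularEmbedding {ℓ} (B C : CompleteBooleanAlgebra ℓ)
                          (i : Carrier B → Carrier C) : Set (suc ℓ) where
  private
    module B = CompleteBooleanAlgebra B
    module C = CompleteBooleanAlgebra C
  field
    cong       : ∀ {x y} → x B.≈ y → i x C.≈ i y
    injective  : ∀ {x y} → i x C.≈ i y → x B.≈ y
    hom-∧      : ∀ x y → i (x B.∧ y) C.≈ (i x C.∧ i y)
    hom-∨      : ∀ x y → i (x B.∨ y) C.≈ (i x C.∨ i y)
    hom-¬      : ∀ x → i (B.¬ x) C.≈ (C.¬ (i x))
    hom-⊤      : i B.⊤ C.≈ C.⊤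
    hom-⊥      : i B.⊥ C.≈ C.⊥
    hom-⋁      : (S : Carrier B → Set ℓ) →
                 i (B.⋁ S) C.≈ C.⋁ (λ y → Σ (Carrier B) (λ x → S x × (i x C.≈ y)))

retraction : ∀ {ℓ} (B C : CompleteBooleanAlgebra ℓ) →
             (Carrier B → Carrier C) → Carrier C → Carrier B
retraction B C i c = CompleteBooleanAlgebra.⋀ B
  (λ b → CompleteBooleanAlgebra._≤_ C c (i b))

record Ordinal (ℓ : Level) : Set (suc ℓ) where
  field
    Idx         : Set ℓ
    _<_         : Idx → Idx → Set ℓ
    isSTO       : IsStrictTotalOrder _≡_ _<_
    wellFounded : WellFounded _<_

  _≤_ : Idx → Idx → Set ℓ
  α ≤ β = (α < β) ⊎ (α ≡ β)

record CompleteIterationSystem {ℓ} (λ' : Ordinal ℓ) : Set (suc ℓ) where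
  open Ordinal λ'
  field
    𝔹   : Idx → CompleteBooleanAlgebra ℓ
    i   : ∀ {α β} → α ≤ β → Carrier (𝔹 α) → Carrier (𝔹 β)
    regular : ∀ {α β} (p : α ≤ β) → IsRegularEmbedding (𝔹 α) (𝔹 β) (i p)
    i-id    : ∀ {α} (p : α ≤ α) (x : Carrier (𝔹 α)) →
              CompleteBooleanAlgebra._≈_ (𝔹 α) (i p x) x
    i-comp  : ∀ {α β γ} (p : α ≤ β) (q : β ≤ γ) (r : α ≤ γ) (x : Carrier (𝔹 α)) →
              CompleteBooleanAlgebra._≈_ (𝔹 γ) (i q (i p x)) (i r x)

  π : ∀ {α β} → α ≤ β → Carrier (𝔹 β) → Carrier (𝔹 α)
  π {α} {β} p = retraction (𝔹 α) (𝔹 β) (i p)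

  record Thread : Set ℓ where
    constructor thread
    field
      at     : (α : Idx) → Carrier (𝔹 α)
      coh    : ∀ {α β} (p : α ≤ β) →
               CompleteBooleanAlgebra._≈_ (𝔹 α) (π p (at β)) (at α)
  open Thread public

  Tuple : Set ℓ
  Tuple = (α : Idx) → Carrier (𝔹 α)

  _≤ᵗ_ : Thread → Tuple → Set ℓ
  f ≤ᵗ x = ∀ α → CompleteBooleanAlgebra._≤_ (𝔹 α) (at f α) (x α)

  _≐_ : Thread → Thread → Set ℓ
  f ≐ g = ∀ α → CompleteBooleanAlgebra._≈_ (𝔹 α) (at f α) (at g α)

  Nonzero : Thread → Set ℓ
  Nonzero f = ¬ (∀ α → CompleteBooleanAlgebra._≈_ (𝔹 α) (at f α)
                                                (CompleteBooleanAlgebra.⊥ (𝔹 α)))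

  Incompatible : Thread → Thread → Set ℓ
  Incompatible f g = ¬ (Σ Thread λ h → Nonzero h × h ≤ᵗ at f × h ≤ᵗ at g)

  IsAntichain : (Thread → Set ℓ) → Set ℓ
  IsAntichain A = ∀ f g → A f → A g → ¬ (f ≐ g) → Incompatible f g

  -- π_{αλ}[A] is an antichain of 𝔹_α: distinct members of A have
  -- disjoint α-th coordinates
  ProjAntichain : (Thread → Set ℓ) → Idx → Set ℓ
  ProjAntichain A α = ∀ f g → A f → A g → ¬ (f ≐ g) →
    CompleteBooleanAlgebra._≈_ (𝔹 α)
      (CompleteBooleanAlgebra._∧_ (𝔹 α) (at f α) (at g α))
      (CompleteBooleanAlgebra.⊥ (𝔹 α))

  pointwiseSup : (Thread → Set ℓ) → Tuple
  pointwiseSup A α = CompleteBooleanAlgebra.⋁ (𝔹 α)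
    (λ x → Σ Thread λ f → A f × CompleteBooleanAlgebra._≈_ (𝔹 α) (at f α) x)

  -- RO(T(F)): regular open subsets of the poset P of nonzero threads
  -- (open = downward closed).
  -- The supremum in RO(P) of a family of opens is int(cl(union)),
  -- and the dense embedding P → RO(P) sends p to int(cl(↓p)).

  IntCl : (Thread → Set ℓ) → Thread → Set ℓ
  IntCl U p = Nonzero p ×
    (∀ q → q ≤ᵗ at p → Nonzero q → Σ Thread λ r → r ≤ᵗ at q × Nonzero r × U r)

  ROelem : Tuple → Thread → Set ℓ
  ROelem x = IntCl (λ r → r ≤ᵗ x)

  ROsup : (Thread → Set ℓ) → Thread → Set ℓ
  ROsup A = IntCl (λ r → Σ Thread λ f → A f × r ≤ᵗ at f)

{-# OPTIONS --safe #-}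
-- Since ~⋁A bounds A, it suffices that every nonzero thread r ≤ ~⋁A has a nonzero part
-- below a member of A. As 0 ≠ r(α) ≤ ⋁ {f(α) : f ∈ A}, some f ∈ A has r(α) ∧ f(α) ≠ 0.
-- The thread h equal to r(γ) ∧ i_{αγ}(f(α)) for γ ≥ α (and to its projections below α)
-- is then nonzero and below r. Every other g ∈ A has g(γ) ≤ i_{αγ}(g(α)), disjoint from
-- i_{αγ}(f(α)) since π_{αλ}[A] is an antichain; so ~⋁A(γ) ∧ i_{αγ}(f(α)) ≤ f(γ), i.e. h ≤ f.
module Submission where

open import Defs
open import Level using (Level)
open import Data.Product using (Σ; _×_; _,_)
open import Data.Sum using (inj₁; inj₂)
open import Function.Bundles using (_⇔_; mk⇔)
open import Axiom.ExcludedMiddle using (ExcludedMiddle)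
open import Relation.Nullary using (yes; no; contradiction)
open import Relation.Nullary.Decidable using (decidable-stable)
open import Relation.Binary.Bundles using (Poset; StrictTotalOrder; DecTotalOrder)
open import Relation.Binary.Structures using (IsPartialOrder)
import Relation.Binary.Lattice as RL
import Relation.Binary.Reasoning.PartialOrder as PosetReasoning
import Relation.Binary.Reasoning.Setoid as SetoidReasoning
import Relation.Binary.Properties.StrictTotalOrder as StrictTotalOrderProperties

module BooleanOrder {ℓ : Level} (B : CompleteBooleanAlgebra ℓ) where
  open CompleteBooleanAlgebra B
  open import Algebra.Lattice.Properties.BooleanAlgebra boolAlg
    using ( ∨-∧-orderTheoreticLattice; ∧-identityʳ; ∧-zeroʳ; ∨-identityʳ; ∨-identityˡ
          ; ∧-idem; ¬-involutive )
  private
    module Std = RL.Lattice ∨-∧-orderTheoreticLattice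

  -- The library orders a lattice by x ≈ x ∧ y; here x ≤ y is x ∧ y ≈ x.
  ≤-isPartialOrder : IsPartialOrder _≈_ _≤_
  ≤-isPartialOrder = record
    { isPreorder = record
      { isEquivalence = isEquivalence
      ; reflexive     = λ x≈y → sym (Std.reflexive x≈y)
      ; trans         = λ x≤y y≤z → sym (Std.trans (sym x≤y) (sym y≤z))
      }
    ; antisym = λ x≤y y≤x → Std.antisym (sym x≤y) (sym y≤x)
    }

  poset : Poset ℓ ℓ ℓ
  poset = record { isPartialOrder = ≤-isPartialOrder }

  open Poset poset public
    using ()
    renaming (refl to ≤-refl; reflexive to ≤-reflexive; trans to ≤-trans; antisym to ≤-antisym)
  module ≤-Reasoning = PosetReasoning poset

  x∧y≤x : ∀ x y → (x ∧ y) ≤ x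
  x∧y≤x x y = sym (Std.x∧y≤x x y)

  x∧y≤y : ∀ x y → (x ∧ y) ≤ y
  x∧y≤y x y = sym (Std.x∧y≤y x y)

  ∧-greatest : ∀ {x y z} → x ≤ y → x ≤ z → x ≤ (y ∧ z)
  ∧-greatest x≤y x≤z = sym (Std.∧-greatest (sym x≤y) (sym x≤z))

  ∧-monotonic : ∀ {x y u v} → x ≤ y → u ≤ v → (x ∧ u) ≤ (y ∧ v)
  ∧-monotonic {x} {u = u} x≤y u≤v =
    ∧-greatest (≤-trans (x∧y≤x x u) x≤y) (≤-trans (x∧y≤y x u) u≤v)

  x≤x∨y : ∀ x y → x ≤ (x ∨ y)
  x≤x∨y x y = sym (Std.x≤x∨y x y)

  y≤x∨y : ∀ x y → y ≤ (x ∨ y)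
  y≤x∨y x y = sym (Std.y≤x∨y x y)

  ∨-least : ∀ {x y z} → x ≤ z → y ≤ z → (x ∨ y) ≤ z
  ∨-least x≤z y≤z = sym (Std.∨-least (sym x≤z) (sym y≤z))

  ∨-monotonic : ∀ {x y u v} → x ≤ y → u ≤ v → (x ∨ u) ≤ (y ∨ v)
  ∨-monotonic {y = y} {v = v} x≤y u≤v =
    ∨-least (≤-trans x≤y (x≤x∨y y v)) (≤-trans u≤v (y≤x∨y y v))

  ⊥-minimum : ∀ x → ⊥ ≤ x
  ⊥-minimum x = trans (∧-comm ⊥ x) (∧-zeroʳ x)

  x≤⊥⇒x≈⊥ : ∀ {x} → x ≤ ⊥ → x ≈ ⊥
  x≤⊥⇒x≈⊥ {x} x≤⊥ = ≤-antisym x≤⊥ (⊥-minimum x)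

  ∧≤⇒≤∨¬ : ∀ {x y z} → (x ∧ y) ≤ z → x ≤ (z ∨ ¬ y)
  ∧≤⇒≤∨¬ {x} {y} {z} x∧y≤z = begin
    x                   ≈⟨ sym (∧-identityʳ x) ⟩
    x ∧ ⊤               ≈⟨ ∧-cong refl (sym (∨-complementʳ y)) ⟩
    x ∧ (y ∨ ¬ y)       ≈⟨ ∧-distribˡ-∨ x y (¬ y) ⟩
    (x ∧ y) ∨ (x ∧ ¬ y) ≤⟨ ∨-monotonic x∧y≤z (x∧y≤y x (¬ y)) ⟩
    z ∨ ¬ y             ∎
    where open ≤-Reasoning

  ≤∨¬⇒∧≤ : ∀ {x y z} → x ≤ (z ∨ ¬ y) → (x ∧ y) ≤ z
  ≤∨¬⇒∧≤ {x} {y} {z} x≤z∨¬y = begin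
    x ∧ y                   ≤⟨ ∧-monotonic x≤z∨¬y ≤-refl ⟩
    (z ∨ ¬ y) ∧ y           ≈⟨ ∧-distribʳ-∨ y z (¬ y) ⟩
    (z ∧ y) ∨ (¬ y ∧ y)     ≈⟨ ∨-cong refl (∧-complementˡ y) ⟩
    (z ∧ y) ∨ ⊥             ≈⟨ ∨-identityʳ (z ∧ y) ⟩
    z ∧ y                   ≤⟨ x∧y≤x z y ⟩
    z                       ∎
    where open ≤-Reasoning

  disjoint⇒≤¬ : ∀ {x y} → x ∧ y ≈ ⊥ → x ≤ (¬ y)
  disjoint⇒≤¬ {y = y} x∧y≈⊥ =
    ≤-trans (∧≤⇒≤∨¬ (≤-reflexive x∧y≈⊥)) (≤-reflexive (∨-identityˡ (¬ y)))

  ≤¬⇒disjoint : ∀ {x y} → x ≤ (¬ y) → x ∧ y ≈ ⊥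
  ≤¬⇒disjoint {y = y} x≤¬y =
    x≤⊥⇒x≈⊥ (≤∨¬⇒∧≤ (≤-trans x≤¬y (≤-reflexive (sym (∨-identityˡ (¬ y))))))

  ≤¬-swap : ∀ {x y} → x ≤ (¬ y) → y ≤ (¬ x)
  ≤¬-swap {x} {y} x≤¬y = disjoint⇒≤¬ (trans (∧-comm y x) (≤¬⇒disjoint x≤¬y))

  ¬-antitone : ∀ {x y} → x ≤ y → (¬ y) ≤ (¬ x)
  ¬-antitone {x} {y} x≤y =
    ≤¬-swap (≤-trans x≤y (≤-reflexive (sym (¬-involutive y))))

  ¬≤-swap : ∀ {x y} → (¬ x) ≤ y → (¬ y) ≤ x
  ¬≤-swap {x} ¬x≤y = ≤-trans (¬-antitone ¬x≤y) (≤-reflexive (¬-involutive x))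

  ⋁-meets : ExcludedMiddle ℓ → ∀ S {x} → x ≉ ⊥ → x ≤ ⋁ S →
            Σ Carrier λ s → S s × x ∧ s ≉ ⊥
  ⋁-meets em S {x} x≉⊥ x≤⋁S with em {Σ Carrier λ s → S s × x ∧ s ≉ ⊥}
  ... | yes meets = meets
  ... | no misses = contradiction x≈⊥ x≉⊥
    where
    ⋁S≤¬x : ⋁ S ≤ (¬ x)
    ⋁S≤¬x = ⋁-least S (¬ x) λ s Ss → ≤¬-swap (disjoint⇒≤¬
      (decidable-stable em λ x∧s≉⊥ → misses (s , Ss , x∧s≉⊥)))
    x≈⊥ : x ≈ ⊥
    x≈⊥ = trans (sym (∧-idem x)) (≤¬⇒disjoint (≤-trans x≤⋁S ⋁S≤¬x))

open CompleteBooleanAlgebra using (Carrier)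

module RegularEmbeddingProperties {ℓ : Level} {B C : CompleteBooleanAlgebra ℓ}
  {i : Carrier B → Carrier C} (regular : IsRegularEmbedding B C i) where
  private
    module B = CompleteBooleanAlgebra B
    module C = CompleteBooleanAlgebra C
    module OB = BooleanOrder B
    module OC = BooleanOrder C
  open IsRegularEmbedding regular

  π : Carrier C → Carrier B
  π = retraction B C i

  i-mono : ∀ {x y} → x B.≤ y → i x C.≤ i y
  i-mono {x} {y} x≤y = C.trans (C.sym (hom-∧ x y)) (cong x≤y)

  ≤i⇒π≤ : ∀ {c b} → c C.≤ i b → π c B.≤ b
  ≤i⇒π≤ {c} {b} c≤ib = B.⋁-least _ b (λ x x≤lower → x≤lower b c≤ib)

  -- t = ⋁ { b : i b ≤ ¬ c } still has i t ≤ ¬ c as i preserves suprema; so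
  -- c ≤ i (¬ t), and ¬ t ≤ π c since ¬ t lies below every b with c ≤ i b.
  ≤iπ : ∀ c → c C.≤ i (π c)
  ≤iπ c = OC.≤-trans c≤i¬t (i-mono ¬t≤πc)
    where
    Disjoint : Carrier B → Set ℓ
    Disjoint b = i b C.≤ (C.¬ c)
    t : Carrier B
    t = B.⋁ Disjoint
    it≤¬c : i t C.≤ (C.¬ c)
    it≤¬c = OC.≤-trans (OC.≤-reflexive (hom-⋁ Disjoint)) (C.⋁-least _ _ λ y (x , ix≤¬c , ix≈y) →
      OC.≤-trans (OC.≤-reflexive (C.sym ix≈y)) ix≤¬c)
    c≤i¬t : c C.≤ i (B.¬ t)
    c≤i¬t = OC.≤-trans (OC.≤¬-swap it≤¬c) (OC.≤-reflexive (C.sym (hom-¬ t)))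
    ¬t≤πc : (B.¬ t) B.≤ π c
    ¬t≤πc = B.⋁-upper _ _ λ b c≤ib → OB.¬≤-swap (B.⋁-upper Disjoint (B.¬ b)
      (OC.≤-trans (OC.≤-reflexive (hom-¬ b)) (OC.¬-antitone c≤ib)))

  π≤⇒≤i : ∀ {c b} → π c B.≤ b → c C.≤ i b
  π≤⇒≤i πc≤b = OC.≤-trans (≤iπ _) (i-mono πc≤b)

  π-mono : ∀ {c d} → c C.≤ d → π c B.≤ π d
  π-mono c≤d = ≤i⇒π≤ (OC.≤-trans c≤d (≤iπ _))

  π-cong : ∀ {c d} → c C.≈ d → π c B.≈ π d
  π-cong c≈d =
    OB.≤-antisym (π-mono (OC.≤-reflexive c≈d)) (π-mono (OC.≤-reflexive (C.sym c≈d)))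

  π-⊥ : π C.⊥ B.≈ B.⊥
  π-⊥ = OB.x≤⊥⇒x≈⊥ (≤i⇒π≤ (OC.⊥-minimum _))

  π-∧-i : ∀ c b → π (c C.∧ i b) B.≈ π c B.∧ b
  π-∧-i c b = OB.≤-antisym
    (OB.∧-greatest (π-mono (OC.x∧y≤x c (i b))) (≤i⇒π≤ (OC.x∧y≤y c (i b))))
    (OB.≤∨¬⇒∧≤ (≤i⇒π≤ (OC.≤-trans (OC.∧≤⇒≤∨¬ (≤iπ _)) (OC.≤-reflexive (C.sym i[z∨¬b])))))
    where
    z : Carrier B
    z = π (c C.∧ i b)
    i[z∨¬b] : i (z B.∨ B.¬ b) C.≈ i z C.∨ C.¬ i b
    i[z∨¬b] = C.trans (hom-∨ z (B.¬ b)) (C.∨-cong C.refl (hom-¬ b))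

module IterationSystemProperties {ℓ : Level} {λ' : Ordinal ℓ} (F : CompleteIterationSystem λ')
  where
  open Ordinal λ'
  open CompleteIterationSystem F
  private
    module 𝔹 α = CompleteBooleanAlgebra (𝔹 α)
    module O α = BooleanOrder (𝔹 α)
    module E {α β} (p : α ≤ β) = RegularEmbeddingProperties (regular p)
    module ≈-Reasoning α = SetoidReasoning (𝔹.setoid α)
    strictTotalOrder : StrictTotalOrder ℓ ℓ ℓ
    strictTotalOrder = record { isStrictTotalOrder = isSTO }

  open DecTotalOrder (StrictTotalOrderProperties.decTotalOrder strictTotalOrder)
    using () renaming (refl to ≤-refl; trans to ≤-trans; total to ≤-total)

  upperBound : ∀ α β → Σ Idx λ γ → α ≤ γ × β ≤ γ
  upperBound α β with ≤-total α β
  ... | inj₁ α≤β = β , α≤β , ≤-refl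
  ... | inj₂ β≤α = α , ≤-refl , β≤α

  π-id : ∀ {α} (p : α ≤ α) c → 𝔹._≈_ α (π p c) c
  π-id {α} p c = O.≤-antisym α
    (E.≤i⇒π≤ p (O.≤-reflexive α (𝔹.sym α (i-id p c))))
    (O.≤-trans α (E.≤iπ p c) (O.≤-reflexive α (i-id p (π p c))))

  π-comp : ∀ {β α γ} (q : β ≤ α) (p : α ≤ γ) (r : β ≤ γ) c →
           𝔹._≈_ β (π q (π p c)) (π r c)
  π-comp {β} {α} {γ} q p r c = O.≤-antisym β
    (E.≤i⇒π≤ q (E.≤i⇒π≤ p (begin
      c                         ≤⟨ E.≤iπ r c ⟩
      i r (π r c)               ≈⟨ 𝔹.sym γ (i-comp q p r _) ⟩
      i p (i q (π r c))         ∎)))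
    (E.≤i⇒π≤ r (begin
      c                         ≤⟨ E.≤iπ p c ⟩
      i p (π p c)               ≤⟨ E.i-mono p (E.≤iπ q (π p c)) ⟩
      i p (i q (π q (π p c)))   ≈⟨ i-comp q p r _ ⟩
      i r (π q (π p c))         ∎))
    where open O.≤-Reasoning γ

  at≤i-at : ∀ (f : Thread) {α β} (p : α ≤ β) → 𝔹._≤_ β (at f β) (i p (at f α))
  at≤i-at f {α} p = E.π≤⇒≤i p (O.≤-reflexive α (coh f p))

  Nonzero⇒at≉⊥ : ∀ {f} → Nonzero f → ∀ α → 𝔹._≉_ α (at f α) (𝔹.⊥ α)
  Nonzero⇒at≉⊥ {f} f≢0 α fα≈⊥ = f≢0 λ β → let γ , a , b = upperBound α β in
    𝔹.trans β (𝔹.sym β (coh f b)) (𝔹.trans β (E.π-cong b (fγ≈⊥ a)) (E.π-⊥ b))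
    where
    fγ≈⊥ : ∀ {γ} (a : α ≤ γ) → 𝔹._≈_ γ (at f γ) (𝔹.⊥ γ)
    fγ≈⊥ {γ} a = O.x≤⊥⇒x≈⊥ γ (O.≤-trans γ (at≤i-at f a) (O.≤-reflexive γ ia[fα]≈⊥))
      where
      open IsRegularEmbedding (regular a)
      ia[fα]≈⊥ : 𝔹._≈_ γ (i a (at f α)) (𝔹.⊥ γ)
      ia[fα]≈⊥ = 𝔹.trans γ (cong fα≈⊥) hom-⊥

  at-disjoint-above : ∀ (f : Thread) {α γ} (a : α ≤ γ) {b} →
    𝔹._≈_ α (𝔹._∧_ α (at f α) b) (𝔹.⊥ α) →
    𝔹._≈_ γ (𝔹._∧_ γ (at f γ) (i a b)) (𝔹.⊥ γ)
  at-disjoint-above f {α} {γ} a {b} fα∧b≈⊥ = O.x≤⊥⇒x≈⊥ γ (begin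
    at f γ ∧ i a b         ≤⟨ O.∧-monotonic γ (at≤i-at f a) (O.≤-refl γ) ⟩
    i a (at f α) ∧ i a b   ≈⟨ 𝔹.sym γ (hom-∧ (at f α) b) ⟩
    i a (at f α ∧α b)      ≈⟨ cong fα∧b≈⊥ ⟩
    i a (𝔹.⊥ α)            ≈⟨ hom-⊥ ⟩
    ⊥                      ∎)
    where
    open 𝔹 γ using (_∧_; ⊥)
    open 𝔹 α using () renaming (_∧_ to _∧α_)
    open IsRegularEmbedding (regular a)
    open O.≤-Reasoning γ

  module Extension {α : Idx} (k : ∀ {γ} → α ≤ γ → Carrier (𝔹 γ))
    (k-coh : ∀ {γ δ} (a : α ≤ γ) (q : γ ≤ δ) (a' : α ≤ δ) → 𝔹._≈_ γ (π q (k a')) (k a))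
    where

    π-k-independent : ∀ {β γ γ'} (a : α ≤ γ) (b : β ≤ γ) (a' : α ≤ γ') (b' : β ≤ γ') →
                      𝔹._≈_ β (π b (k a)) (π b' (k a'))
    π-k-independent {β} {γ} {γ'} a b a' b' with upperBound γ γ'
    ... | δ , c , c' = begin
      π b (k a)             ≈⟨ E.π-cong b (𝔹.sym γ (k-coh a c a″)) ⟩
      π b (π c (k a″))      ≈⟨ π-comp b c r _ ⟩
      π r (k a″)            ≈⟨ 𝔹.sym β (π-comp b' c' r _) ⟩
      π b' (π c' (k a″))    ≈⟨ E.π-cong b' (k-coh a' c' a″) ⟩
      π b' (k a')           ∎
      where
      open ≈-Reasoning β
      a″ : α ≤ δ
      a″ = ≤-trans a c
      r : β ≤ δ
      r = ≤-trans b c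

    value : ∀ β → Carrier (𝔹 β)
    value β = let _ , a , b = upperBound α β in π b (k a)

    value-at : ∀ {β γ} (a : α ≤ γ) (b : β ≤ γ) → 𝔹._≈_ β (value β) (π b (k a))
    value-at {β} a b = let _ , a₀ , b₀ = upperBound α β in π-k-independent a₀ b₀ a b

    value-coh : ∀ {β δ} (q : β ≤ δ) → 𝔹._≈_ β (π q (value δ)) (value β)
    value-coh {β} {δ} q = let _ , a , d = upperBound α δ in
      𝔹.trans β (π-comp q d (≤-trans q d) _) (𝔹.sym β (value-at a (≤-trans q d)))

    extension : Thread
    extension = thread value value-coh

    extension-≤ : ∀ (f : Thread) → (∀ {γ} (a : α ≤ γ) → 𝔹._≤_ γ (k a) (at f γ)) →
                  extension ≤ᵗ at f
    extension-≤ f k≤f β = let _ , a , b = upperBound α β in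
      O.≤-trans β (E.π-mono b (k≤f a)) (O.≤-reflexive β (coh f b))

  module _ (r : Thread) {α : Idx} (b : Carrier (𝔹 α)) where

    meetAbove : ∀ {γ} → α ≤ γ → Carrier (𝔹 γ)
    meetAbove {γ} a = 𝔹._∧_ γ (at r γ) (i a b)

    meetAbove-coh : ∀ {γ δ} (a : α ≤ γ) (q : γ ≤ δ) (a' : α ≤ δ) →
                    𝔹._≈_ γ (π q (meetAbove a')) (meetAbove a)
    meetAbove-coh {γ} {δ} a q a' = begin
      π q (at r δ ∧δ i a' b)         ≈⟨ E.π-cong q (𝔹.∧-cong δ (𝔹.refl δ) ia'b≈iq[iab]) ⟩
      π q (at r δ ∧δ i q (i a b))    ≈⟨ E.π-∧-i q (at r δ) (i a b) ⟩
      π q (at r δ) ∧ i a b           ≈⟨ 𝔹.∧-cong γ (coh r q) (𝔹.refl γ) ⟩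
      at r γ ∧ i a b                 ∎
      where
      open 𝔹 γ using (_∧_)
      open 𝔹 δ using () renaming (_∧_ to _∧δ_)
      open ≈-Reasoning γ
      ia'b≈iq[iab] : 𝔹._≈_ δ (i a' b) (i q (i a b))
      ia'b≈iq[iab] = 𝔹.sym δ (i-comp a q a' b)

    open Extension meetAbove meetAbove-coh using (extension; value-at; extension-≤)

    meet : Thread
    meet = extension

    meet-at : 𝔹._≈_ α (at meet α) (𝔹._∧_ α (at r α) b)
    meet-at = begin
      at meet α                       ≈⟨ value-at ≤-refl ≤-refl ⟩
      π ≤-refl (at r α ∧ i ≤-refl b)  ≈⟨ π-id ≤-refl _ ⟩
      at r α ∧ i ≤-refl b             ≈⟨ 𝔹.∧-cong α (𝔹.refl α) (i-id ≤-refl b) ⟩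
      at r α ∧ b                      ∎
      where
      open 𝔹 α using (_∧_)
      open ≈-Reasoning α

    meet-nonzero : 𝔹._≉_ α (𝔹._∧_ α (at r α) b) (𝔹.⊥ α) → Nonzero meet
    meet-nonzero rα∧b≉⊥ meet≈⊥ = rα∧b≉⊥ (𝔹.trans α (𝔹.sym α meet-at) (meet≈⊥ α))

    meet-≤ˡ : meet ≤ᵗ at r
    meet-≤ˡ = extension-≤ r λ {γ} a → O.x∧y≤x γ (at r γ) (i a b)

    meet-≤ : ∀ (f : Thread) →
             (∀ {γ} (a : α ≤ γ) → 𝔹._≤_ γ (meetAbove a) (at f γ)) →
             meet ≤ᵗ at f
    meet-≤ = extension-≤

  ≤ᵗ-refl : ∀ f → f ≤ᵗ at f
  ≤ᵗ-refl f α = O.≤-refl α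

  ≤ᵗ-trans : ∀ {f g x} → f ≤ᵗ at g → g ≤ᵗ x → f ≤ᵗ x
  ≤ᵗ-trans f≤g g≤x α = O.≤-trans α (f≤g α) (g≤x α)

  IntCl-refine : ∀ {U V : Thread → Set ℓ} →
    (∀ r → Nonzero r → U r → Σ Thread λ s → s ≤ᵗ at r × Nonzero s × V s) →
    ∀ {p} → IntCl U p → IntCl V p
  IntCl-refine {U} {V} refine (p≢0 , dense) =
    p≢0 , λ q q≤p q≢0 → refine-below q (dense q q≤p q≢0)
    where
    refine-below : ∀ q → Σ Thread (λ r → r ≤ᵗ at q × Nonzero r × U r) →
                   Σ Thread (λ s → s ≤ᵗ at q × Nonzero s × V s)
    refine-below q (r , r≤q , r≢0 , Ur) =
      let s , s≤r , s≢0 , Vs = refine r r≢0 Ur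
      in s , ≤ᵗ-trans {s} {r} {at q} s≤r r≤q , s≢0 , Vs

  pointwiseSup-upper : ∀ (A : Thread → Set ℓ) {f} → A f → f ≤ᵗ pointwiseSup A
  pointwiseSup-upper A {f} Af β = 𝔹.⋁-upper β _ _ (f , Af , 𝔹.refl β)

  module _ (em : ExcludedMiddle ℓ) (A : Thread → Set ℓ) {α : Idx} where

    meets-member : ∀ r → Nonzero r → r ≤ᵗ pointwiseSup A →
                   Σ Thread λ f → A f × 𝔹._≉_ α (𝔹._∧_ α (at r α) (at f α)) (𝔹.⊥ α)
    meets-member r r≢0 r≤sup =
      let _ , (f , Af , fα≈x) , rα∧x≉⊥ = O.⋁-meets α em _ (Nonzero⇒at≉⊥ {r} r≢0 α) (r≤sup α)
      in f , Af , λ rα∧fα≈⊥ →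
           rα∧x≉⊥ (𝔹.trans α (𝔹.∧-cong α (𝔹.refl α) (𝔹.sym α fα≈x)) rα∧fα≈⊥)

    module _ (proj : ProjAntichain A α) where

      pointwiseSup-above : ∀ {f} → A f → ∀ {γ} (a : α ≤ γ) →
        𝔹._≤_ γ (pointwiseSup A γ) (𝔹._∨_ γ (at f γ) (𝔹.¬_ γ (i a (at f α))))
      pointwiseSup-above {f} Af {γ} a =
        ⋁-least _ _ λ x (g , Ag , gγ≈x) →
          O.≤-trans γ (O.≤-reflexive γ (sym gγ≈x)) (at-below g Ag)
        where
        open 𝔹 γ using (⋁-least; sym; _∨_; ¬_) renaming (_≤_ to _≤γ_)
        at-below : ∀ g → A g → at g γ ≤γ (at f γ ∨ ¬ i a (at f α))
        at-below g Ag with em {f ≐ g}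
        ... | yes f≐g = O.≤-trans γ (O.≤-reflexive γ (sym (f≐g γ))) (O.x≤x∨y γ _ _)
        ... | no f≉g = O.≤-trans γ (O.disjoint⇒≤¬ γ gγ∧fα≈⊥) (O.y≤x∨y γ _ _)
          where
          gγ∧fα≈⊥ : 𝔹._≈_ γ (𝔹._∧_ γ (at g γ) (i a (at f α))) (𝔹.⊥ γ)
          gγ∧fα≈⊥ = at-disjoint-above g a (𝔹.trans α (𝔹.∧-comm α _ _) (proj f g Af Ag f≉g))

      meet-member-≤ : ∀ r → r ≤ᵗ pointwiseSup A → ∀ {f} → A f → meet r (at f α) ≤ᵗ at f
      meet-member-≤ r r≤sup {f} Af = meet-≤ r (at f α) f λ {γ} a →
        O.≤∨¬⇒∧≤ γ (O.≤-trans γ (r≤sup γ) (pointwiseSup-above Af a))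

      pointwiseSup-dense : ∀ r → Nonzero r → r ≤ᵗ pointwiseSup A →
        Σ Thread λ h → h ≤ᵗ at r × Nonzero h × Σ Thread λ f → A f × h ≤ᵗ at f
      pointwiseSup-dense r r≢0 r≤sup =
        let f , Af , rα∧fα≉⊥ = meets-member r r≢0 r≤sup
        in meet r (at f α) , meet-≤ˡ r (at f α) , meet-nonzero r (at f α) rα∧fα≉⊥ ,
           f , Af , meet-member-≤ r r≤sup Af

lemma3p11 : ∀ {ℓ : Level} → ExcludedMiddle ℓ →
    (λ' : Ordinal ℓ) (F : CompleteIterationSystem λ') →
    let open CompleteIterationSystem F in
    (A : Thread → Set ℓ) → IsAntichain A →
    (α : Ordinal.Idx λ') → ProjAntichain A α →
    ∀ p → ROelem (pointwiseSup A) p ⇔ ROsup A p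
lemma3p11 em λ' F A _ α proj p =
  mk⇔ (IntCl-refine (pointwiseSup-dense em A proj) {p}) (IntCl-refine member-refines {p})
  where
  open CompleteIterationSystem F
  open IterationSystemProperties F
  member-refines : ∀ r → Nonzero r → Σ Thread (λ f → A f × r ≤ᵗ at f) →
                   Σ Thread λ s → s ≤ᵗ at r × Nonzero s × s ≤ᵗ pointwiseSup A
  member-refines r r≢0 (f , Af , r≤f) =
    r , ≤ᵗ-refl r , r≢0 , ≤ᵗ-trans {r} {f} r≤f (pointwiseSup-upper A Af)
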